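{- Let $k\ge1$, $n_1,\ldots,n_k\ge2$, and let $x$ be a vertex of $H_{n_1,\ldots,n_k}$ with $\mathrm{alt}(x)\neq 0$. Then there exists a vertex $y$ adjacent to $x$ with $\mathrm{alt}(y)=\mathrm{alt}(x)-1$, and no vertex $y'$ adjacent to $x$ satisfies $\mathrm{alt}(y')<\mathrm{alt}(x)-1$.
   Context: For integers $n_1,\ldots,n_k\ge 2$, $H_{n_1,\ldots,n_k}$ is the simple graph on the strings $x=x_1\cdots x_k$ with $x_i\in\mathbb{Z}_{n_i}=\{0,\ldots,n_i-1\}$, where, writing $0^m$ for $m$ zeros and $w$ for a possibly empty common suffix, two distinct vertices are adjacent iff: (A0) $x=a\,w$, $y=b\,w$ with $a\neq b$; or (A1) for some $1\le m\le k$, $x=0^m w$ and $y=c_1\cdots c_m w$ with all $c_j\neq0$, or vice versa; or (A2) for some $1\le i\le k$, $x=0^{i-1}a\,w$, $y=0^{i-1}b\,w$ with $a,b\neq 0$, $a\ne b$. The alternating number $\mathrm{alt}(x)$ is the number of indices $j\in\{1,\ldots,k\}$ such that exactly one of $x_j,x_{j+1}$ is $0$, with $x_{k+1}:=0$. -}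

module Defs where

open import Data.Nat using (ℕ; zero; suc; _+_; _≤_; _<_)
open import Data.Fin using (Fin; toℕ)

open import Data.Bool using (Bool; true; false; _xor_; if_then_else_)
open import Data.List using (List; []; _∷_; map; allFin)
open import Data.Product using (Σ; _×_)
open import Data.Sum using (_⊎_)
open import Relation.Binary.PropositionalEquality using (_≡_; _≢_)
open import Relation.Nullary using (¬_)

-- Vertices of H_{n_1,...,n_k}: strings x = x_1 ... x_k with x_i ∈ Z_{n_i}.
-- Position i (1-based in the paper) is the index (i-1 : Fin k) here.
Vertex : {k : ℕ} → (Fin k → ℕ) → Set
Vertex {k} ns = (i : Fin k) → Fin (ns i)

IsZero : ∀ {n} → Fin n → Set
IsZero a = toℕ a ≡ 0

module _ {k : ℕ} {ns : Fin k → ℕ} where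

  -- (A0): x = a w, y = b w, a ≠ b (prefix of length 1)
  A0 : Vertex ns → Vertex ns → Set
  A0 x y = Σ (Fin k) λ p → toℕ p ≡ 0 × x p ≢ y p
         × ((j : Fin k) → 0 < toℕ j → x j ≡ y j)

  -- one direction of (A1): x = 0^m w, y = c_1 ... c_m w, all c_j ≠ 0, 1 ≤ m ≤ k
  A1dir : Vertex ns → Vertex ns → Set
  A1dir x y = Σ ℕ λ m → 1 ≤ m × m ≤ k
            × ((j : Fin k) → toℕ j < m → IsZero (x j))
            × ((j : Fin k) → toℕ j < m → ¬ IsZero (y j))
            × ((j : Fin k) → m ≤ toℕ j → x j ≡ y j)

  A1 : Vertex ns → Vertex ns → Set
  A1 x y = A1dir x y ⊎ A1dir y x

  -- (A2): x = 0^{i-1} a w, y = 0^{i-1} b w, a,b ≠ 0, a ≠ b  (i is 1-based; here p = i-1)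
  A2 : Vertex ns → Vertex ns → Set
  A2 x y = Σ (Fin k) λ p →
             ((j : Fin k) → toℕ j < toℕ p → IsZero (x j) × IsZero (y j))
           × ¬ IsZero (x p) × ¬ IsZero (y p) × x p ≢ y p
           × ((j : Fin k) → toℕ p < toℕ j → x j ≡ y j)

  Adjacent : Vertex ns → Vertex ns → Set
  Adjacent x y = ¬ ((i : Fin k) → x i ≡ y i) × (A0 x y ⊎ A1 x y ⊎ A2 x y)

isZeroᵇ : ∀ {n} → Fin n → Bool
isZeroᵇ a with toℕ a
... | zero = true
... | suc _ = false

-- number of j ∈ {1..len} such that exactly one of b_j, b_{j+1} is true,
-- where b_{len+1} := true  (true = "is zero")
altFlags : List Bool → ℕ
altFlags [] = 0
altFlags (b ∷ []) = if b xor true then 1 else 0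
altFlags (b ∷ c ∷ r) = (if b xor c then 1 else 0) + altFlags (c ∷ r)

-- alternating number alt(x), with x_{k+1} := 0
alt : {k : ℕ} {ns : Fin k → ℕ} → Vertex ns → ℕ
alt {k} x = altFlags (map (λ i → isZeroᵇ (x i)) (allFin k))

-- alt x only depends on the zero pattern of x: it counts the changes in that pattern, with an
-- extra zero read after the last position. A move of type (A2) keeps the pattern, and moves of
-- types (A0) and (A1) flip a constant initial block of it; flipping such a block changes only
-- the boundary term right after the block, so alt drops by at most one along an edge. Conversely,
-- flip the maximal initial block of equal flags of x (possible by (A1), as every n_i ≥ 2 leaves
-- room for a nonzero symbol): since alt x ≠ 0 the block is followed by the opposite flag, and
-- the flip removes exactly that change.
module Submission where

open import Defs
open import Data.Nat using (ℕ; _≤_; _<_; _∸_; zero; suc; _+_; z≤n; s≤s; _<?_)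
open import Data.Nat.Properties using (module ≤-Reasoning; <-cmp; m≤n⇒m≤1+n; ≤-reflexive; ≤-refl; m≤m+n; +-monoʳ-≤; +-comm; +-assoc; +-identityʳ; ≤⇒≯; ∸-monoˡ-≤)
open import Data.Fin using (Fin; zero; suc; toℕ)
open import Data.Fin.Properties using (toℕ-injective)
open import Data.Bool using (Bool; true; false; not; _xor_; if_then_else_)
open import Data.Bool.Properties using (xor-same; xor-inverseʳ; ¬-not; not-¬) renaming (_≟_ to _≟ᵇ_)
open import Data.List using (tabulate)
open import Data.List.Properties using (map-tabulate; tabulate-cong)
open import Data.Product using (Σ; _×_; _,_; proj₁; proj₂)
open import Data.Sum using (_⊎_; inj₁; inj₂)
open import Function using (_∘_; id)
open import Relation.Binary.PropositionalEquality using (_≡_; _≢_; refl; sym; trans; cong; cong₂; subst; subst₂; module ≡-Reasoning)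
open import Relation.Nullary using (¬_; yes; no; contradiction)
open import Relation.Binary using (tri<; tri≈; tri>)

indicator : Bool → ℕ
indicator b = if b then 1 else 0

indicator≤1 : ∀ b → indicator b ≤ 1
indicator≤1 true = ≤-refl
indicator≤1 false = z≤n

transitions : ∀ {n} → (Fin n → Bool) → ℕ
transitions f = altFlags (tabulate f)

-- f i, read as true past the last position (the paper's convention x_{k+1} := 0).
flagAt : ∀ {n} → (Fin n → Bool) → ℕ → Bool
flagAt {zero} f i = true
flagAt {suc n} f zero = f zero
flagAt {suc n} f (suc i) = flagAt (f ∘ suc) i

flagAt-cong : ∀ {n} {f g : Fin n → Bool} → (∀ j → f j ≡ g j) → ∀ i → flagAt f i ≡ flagAt g i
flagAt-cong {zero} f≡g i = refl
flagAt-cong {suc n} f≡g zero = f≡g zero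
flagAt-cong {suc n} f≡g (suc i) = flagAt-cong (f≡g ∘ suc) i

transitions-cong : ∀ {n} {f g : Fin n → Bool} → (∀ j → f j ≡ g j) → transitions f ≡ transitions g
transitions-cong f≡g = cong altFlags (tabulate-cong f≡g)

transitions-suc : ∀ {n} (f : Fin (suc n) → Bool) →
  transitions f ≡ indicator (f zero xor flagAt (f ∘ suc) 0) + transitions (f ∘ suc)
transitions-suc {zero} f = sym (+-identityʳ _)
transitions-suc {suc n} f = refl

transitions-collapse : ∀ {n} (f : Fin (suc (suc n)) → Bool) → f (suc zero) ≡ f zero →
  transitions f ≡ transitions (f ∘ suc)
transitions-collapse f f₁≡f₀ =
  trans (cong (λ b → indicator (f zero xor b) + transitions (f ∘ suc)) f₁≡f₀)
        (cong (λ b → indicator b + transitions (f ∘ suc)) (xor-same (f zero)))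

transitions-sameTail : ∀ {n} (f g : Fin (suc n) → Bool) → (∀ j → f (suc j) ≡ g (suc j)) →
  transitions f + indicator (g zero xor flagAt f 1) ≡ transitions g + indicator (f zero xor flagAt f 1)
transitions-sameTail f g tail =
  begin
    transitions f + indicator (g zero xor c)
  ≡⟨ cong (_+ indicator (g zero xor c)) (transitions-suc f) ⟩
    indicator (f zero xor c) + transitions (f ∘ suc) + indicator (g zero xor c)
  ≡⟨ swap (indicator (f zero xor c)) (transitions (f ∘ suc)) (indicator (g zero xor c)) ⟩
    indicator (g zero xor c) + transitions (f ∘ suc) + indicator (f zero xor c)
  ≡⟨ cong₂ (λ c′ t → indicator (g zero xor c′) + t + indicator (f zero xor c))
           (flagAt-cong tail 0) (transitions-cong tail) ⟩
    indicator (g zero xor flagAt (g ∘ suc) 0) + transitions (g ∘ suc) + indicator (f zero xor c)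
  ≡⟨ cong (_+ indicator (f zero xor c)) (sym (transitions-suc g)) ⟩
    transitions g + indicator (f zero xor c)
  ∎
  where
  open ≡-Reasoning
  c = flagAt (f ∘ suc) 0
  swap : ∀ p t q → p + t + q ≡ q + t + p
  swap p t q = trans (+-comm (p + t) q) (trans (cong (q +_) (+-comm p t)) (sym (+-assoc q t p)))

-- The flipped block consists of the positions 0 … m, so it has length suc m.
record PrefixFlip {n} (m : ℕ) (b : Bool) (f g : Fin n → Bool) : Set where
  field
    prefixˡ : ∀ j → toℕ j < suc m → f j ≡ b
    prefixʳ : ∀ j → toℕ j < suc m → g j ≡ not b
    suffix  : ∀ j → m < toℕ j → f j ≡ g j

PrefixFlip-tail : ∀ {n m b} {f g : Fin (suc n) → Bool} →
  PrefixFlip (suc m) b f g → PrefixFlip m b (f ∘ suc) (g ∘ suc)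
PrefixFlip-tail pf = record
  { prefixˡ = λ j j<m → prefixˡ (suc j) (s≤s j<m)
  ; prefixʳ = λ j j<m → prefixʳ (suc j) (s≤s j<m)
  ; suffix  = λ j m<j → suffix (suc j) (s≤s m<j)
  }
  where open PrefixFlip pf

-- Inside the block nothing changes; only the boundary term at position suc m is affected.
transitions-prefixFlip : ∀ {n m b} {f g : Fin (suc n) → Bool} → PrefixFlip m b f g →
  transitions f + indicator (not b xor flagAt f (suc m)) ≡ transitions g + indicator (b xor flagAt f (suc m))
transitions-prefixFlip {m = zero} {f = f} {g} pf =
  subst₂ (λ p q → transitions f + indicator (q xor flagAt f 1) ≡ transitions g + indicator (p xor flagAt f 1))
    (prefixˡ zero (s≤s z≤n)) (prefixʳ zero (s≤s z≤n))
    (transitions-sameTail f g (λ j → suffix (suc j) (s≤s z≤n)))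
  where open PrefixFlip pf
transitions-prefixFlip {zero} {suc m} {f = f} {g} pf = transitions-prefixFlip {m = zero} {f = f} {g} record
  { prefixˡ = λ { zero _ → prefixˡ zero (s≤s z≤n) }
  ; prefixʳ = λ { zero _ → prefixʳ zero (s≤s z≤n) }
  ; suffix  = λ { zero () }
  }
  where open PrefixFlip pf
transitions-prefixFlip {suc n} {suc m} {b} {f} {g} pf =
  begin
    transitions f + p         ≡⟨ cong (_+ p) (transitions-collapse f (sameAsHead prefixˡ)) ⟩
    transitions (f ∘ suc) + p ≡⟨ transitions-prefixFlip (PrefixFlip-tail pf) ⟩
    transitions (g ∘ suc) + q ≡⟨ cong (_+ q) (sym (transitions-collapse g (sameAsHead prefixʳ))) ⟩
    transitions g + q         ∎
  where
  open ≡-Reasoning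
  open PrefixFlip pf
  p = indicator (not b xor flagAt f (suc (suc m)))
  q = indicator (b xor flagAt f (suc (suc m)))
  sameAsHead : ∀ {h : Fin (suc (suc n)) → Bool} {c} → (∀ j → toℕ j < suc (suc m) → h j ≡ c) → h (suc zero) ≡ h zero
  sameAsHead h≡c = trans (h≡c (suc zero) (s≤s (s≤s z≤n))) (sym (h≡c zero (s≤s z≤n)))

transitions-prefixFlip-≤ : ∀ {n m b} {f g : Fin (suc n) → Bool} → PrefixFlip m b f g →
  transitions f ≤ suc (transitions g)
transitions-prefixFlip-≤ {m = m} {b} {f} {g} pf =
  begin
    transitions f                                          ≤⟨ m≤m+n _ _ ⟩
    transitions f + indicator (not b xor flagAt f (suc m)) ≡⟨ transitions-prefixFlip pf ⟩
    transitions g + indicator (b xor flagAt f (suc m))     ≤⟨ +-monoʳ-≤ _ (indicator≤1 _) ⟩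
    transitions g + 1                                      ≡⟨ +-comm _ 1 ⟩
    suc (transitions g)                                    ∎
  where open ≤-Reasoning

transitions-prefixFlip-suc : ∀ {n m b} {f g : Fin (suc n) → Bool} → PrefixFlip m b f g →
  flagAt f (suc m) ≡ not b → transitions f ≡ suc (transitions g)
transitions-prefixFlip-suc {m = m} {b} {f} {g} pf blockEnds =
  begin
    transitions f                               ≡⟨ sym (+-identityʳ _) ⟩
    transitions f + 0                           ≡⟨ cong (λ c → transitions f + indicator c) (sym (xor-same (not b))) ⟩
    transitions f + indicator (not b xor not b) ≡⟨ atBoundary ⟩
    transitions g + indicator (b xor not b)     ≡⟨ cong (λ c → transitions g + indicator c) (xor-inverseʳ b) ⟩
    transitions g + 1                           ≡⟨ +-comm _ 1 ⟩
    suc (transitions g)                         ∎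
  where
  open ≡-Reasoning
  atBoundary : transitions f + indicator (not b xor not b) ≡ transitions g + indicator (b xor not b)
  atBoundary = subst (λ c → transitions f + indicator (not b xor c) ≡ transitions g + indicator (b xor c))
                     blockEnds (transitions-prefixFlip pf)

initialBlock-ends : ∀ {n} (f : Fin (suc n) → Bool) → transitions f ≢ 0 →
  Σ ℕ λ m → m ≤ n × (∀ j → toℕ j < suc m → f j ≡ f zero) × flagAt f (suc m) ≡ not (f zero)
initialBlock-ends {zero} f t≢0 with f zero in f₀
... | false = 0 , z≤n , (λ { zero _ → f₀ }) , refl
... | true = contradiction refl t≢0
initialBlock-ends {suc n} f t≢0 with f (suc zero) ≟ᵇ f zero
... | no f₁≢f₀ = 0 , z≤n , (λ { zero _ → refl ; (suc j) (s≤s ()) }) , ¬-not f₁≢f₀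
... | yes f₁≡f₀ with initialBlock-ends (f ∘ suc) (t≢0 ∘ trans (transitions-collapse f f₁≡f₀))
...   | m , m≤n , block , ends =
  suc m , s≤s m≤n , block′ , subst (λ b → flagAt (f ∘ suc) (suc m) ≡ not b) f₁≡f₀ ends
  where
  block′ : ∀ j → toℕ j < suc (suc m) → f j ≡ f zero
  block′ zero _ = refl
  block′ (suc j) (s≤s j≤m) = trans (block j j≤m) f₁≡f₀

equal-or-headFlip : ∀ {n} (f g : Fin (suc n) → Bool) → (∀ j → 0 < toℕ j → f j ≡ g j) →
  (∀ j → f j ≡ g j) ⊎ PrefixFlip 0 (f zero) f g
equal-or-headFlip f g tail with g zero ≟ᵇ f zero
... | yes g₀≡f₀ = inj₁ λ { zero → sym g₀≡f₀ ; (suc j) → tail (suc j) (s≤s z≤n) }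
... | no g₀≢f₀ = inj₂ record
  { prefixˡ = λ { zero _ → refl ; (suc j) (s≤s ()) }
  ; prefixʳ = λ { zero _ → ¬-not g₀≢f₀ ; (suc j) (s≤s ()) }
  ; suffix  = tail
  }

isZeroᵇ-true : ∀ {n} (a : Fin n) → IsZero a → isZeroᵇ a ≡ true
isZeroᵇ-true a a≡0 with toℕ a | a≡0
... | zero | _ = refl

isZeroᵇ-false : ∀ {n} (a : Fin n) → ¬ IsZero a → isZeroᵇ a ≡ false
isZeroᵇ-false a a≢0 with toℕ a | a≢0
... | zero  | a≢0′ = contradiction refl a≢0′
... | suc _ | _    = refl

isZeroᵇ-true⁻¹ : ∀ {n} (a : Fin n) → isZeroᵇ a ≡ true → IsZero a
isZeroᵇ-true⁻¹ a isZ with toℕ a | isZ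
... | zero | _ = refl

isZeroᵇ-false⁻¹ : ∀ {n} (a : Fin n) → isZeroᵇ a ≡ false → ¬ IsZero a
isZeroᵇ-false⁻¹ a notZ a≡0 with () ← trans (sym (isZeroᵇ-true a a≡0)) notZ

module _ {k : ℕ} {ns : Fin k → ℕ} where

  zeroFlags : Vertex ns → Fin k → Bool
  zeroFlags x i = isZeroᵇ (x i)

  alt≡transitions : (x : Vertex ns) → alt x ≡ transitions (zeroFlags x)
  alt≡transitions x = cong altFlags (map-tabulate id (zeroFlags x))

module _ {k : ℕ} {ns : Fin (suc k) → ℕ} where

  adjacent⇒zeroFlags : {x y : Vertex ns} → Adjacent x y →
    (∀ j → zeroFlags x j ≡ zeroFlags y j) ⊎ Σ ℕ λ m → Σ Bool λ b → PrefixFlip m b (zeroFlags x) (zeroFlags y)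
  adjacent⇒zeroFlags {x} {y} (_ , inj₁ (_ , _ , _ , tail))
    with equal-or-headFlip (zeroFlags x) (zeroFlags y) (λ j 0<j → cong isZeroᵇ (tail j 0<j))
  ... | inj₁ same = inj₁ same
  ... | inj₂ flip = inj₂ (0 , _ , flip)
  adjacent⇒zeroFlags (_ , inj₂ (inj₁ (inj₁ (suc m , _ , _ , xZero , yNonzero , rest)))) = inj₂ (m , true , record
    { prefixˡ = λ j j≤m → isZeroᵇ-true _ (xZero j j≤m)
    ; prefixʳ = λ j j≤m → isZeroᵇ-false _ (yNonzero j j≤m)
    ; suffix  = λ j m<j → cong isZeroᵇ (rest j m<j)
    })
  adjacent⇒zeroFlags (_ , inj₂ (inj₁ (inj₂ (suc m , _ , _ , yZero , xNonzero , rest)))) = inj₂ (m , false , record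
    { prefixˡ = λ j j≤m → isZeroᵇ-false _ (xNonzero j j≤m)
    ; prefixʳ = λ j j≤m → isZeroᵇ-true _ (yZero j j≤m)
    ; suffix  = λ j m<j → cong isZeroᵇ (sym (rest j m<j))
    })
  adjacent⇒zeroFlags {x} {y} (_ , inj₂ (inj₂ (p , below , xp≢0 , yp≢0 , _ , above))) = inj₁ same
    where
    same : ∀ j → zeroFlags x j ≡ zeroFlags y j
    same j with <-cmp (toℕ j) (toℕ p)
    ... | tri< j<p _ _ = trans (isZeroᵇ-true _ (proj₁ (below j j<p))) (sym (isZeroᵇ-true _ (proj₂ (below j j<p))))
    ... | tri≈ _ j≡p _ rewrite toℕ-injective j≡p = trans (isZeroᵇ-false _ xp≢0) (sym (isZeroᵇ-false _ yp≢0))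
    ... | tri> _ _ p<j = cong isZeroᵇ (above j p<j)

  alt-adjacent-≤ : {x y : Vertex ns} → Adjacent x y → alt x ≤ suc (alt y)
  alt-adjacent-≤ {x} {y} adj
    rewrite alt≡transitions x | alt≡transitions y with adjacent⇒zeroFlags adj
  ... | inj₁ same = m≤n⇒m≤1+n (≤-reflexive (transitions-cong same))
  ... | inj₂ (_ , _ , flip) = transitions-prefixFlip-≤ flip

  prefixFlip⇒adjacent : ∀ {m b} {x y : Vertex ns} → PrefixFlip m b (zeroFlags x) (zeroFlags y) → m ≤ k →
    (∀ j → m < toℕ j → x j ≡ y j) → Adjacent x y
  prefixFlip⇒adjacent {m} {b} {x} {y} flip m≤k rest = distinct , inj₂ (inj₁ (a1 b refl))
    where
    open PrefixFlip flip
    distinct : ¬ (∀ i → x i ≡ y i)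
    distinct x≡y = not-¬ {b} refl
      (trans (sym (prefixˡ zero (s≤s z≤n))) (trans (cong isZeroᵇ (x≡y zero)) (prefixʳ zero (s≤s z≤n))))
    a1 : ∀ b′ → b′ ≡ b → A1 x y
    a1 true refl = inj₁ (suc m , s≤s z≤n , s≤s m≤k ,
      (λ j j≤m → isZeroᵇ-true⁻¹ _ (prefixˡ j j≤m)) , (λ j j≤m → isZeroᵇ-false⁻¹ _ (prefixʳ j j≤m)) , rest)
    a1 false refl = inj₂ (suc m , s≤s z≤n , s≤s m≤k ,
      (λ j j≤m → isZeroᵇ-true⁻¹ _ (prefixʳ j j≤m)) , (λ j j≤m → isZeroᵇ-false⁻¹ _ (prefixˡ j j≤m)) ,
      (λ j m<j → sym (rest j m<j)))

symbolWithFlag : ∀ {n} → 2 ≤ n → Bool → Fin n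
symbolWithFlag (s≤s (s≤s _)) true = zero
symbolWithFlag (s≤s (s≤s _)) false = suc zero

isZeroᵇ-symbolWithFlag : ∀ {n} (2≤n : 2 ≤ n) b → isZeroᵇ (symbolWithFlag 2≤n b) ≡ b
isZeroᵇ-symbolWithFlag (s≤s (s≤s _)) true = refl
isZeroᵇ-symbolWithFlag (s≤s (s≤s _)) false = refl

module _ {k : ℕ} {ns : Fin (suc k) → ℕ} (2≤ns : ∀ i → 2 ≤ ns i) where

  flipPrefix : ℕ → Bool → Vertex ns → Vertex ns
  flipPrefix m b x j with toℕ j <? suc m
  ... | yes _ = symbolWithFlag (2≤ns j) (not b)
  ... | no _  = x j

  flipPrefix-inside : ∀ m b x j → toℕ j < suc m → zeroFlags (flipPrefix m b x) j ≡ not b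
  flipPrefix-inside m b x j j≤m with toℕ j <? suc m
  ... | yes _   = isZeroᵇ-symbolWithFlag (2≤ns j) (not b)
  ... | no j≰m = contradiction j≤m j≰m

  flipPrefix-outside : ∀ m b x j → m < toℕ j → flipPrefix m b x j ≡ x j
  flipPrefix-outside m b x j m<j with toℕ j <? suc m
  ... | yes j≤m = contradiction j≤m (≤⇒≯ m<j)
  ... | no _    = refl

  alt-descent : (x : Vertex ns) → alt x ≢ 0 → Σ (Vertex ns) λ y → Adjacent x y × alt x ≡ suc (alt y)
  alt-descent x alt≢0 with initialBlock-ends (zeroFlags x) (alt≢0 ∘ trans (alt≡transitions x))
  ... | m , m≤k , block , ends =
    y , prefixFlip⇒adjacent flip m≤k (λ j m<j → sym (flipPrefix-outside m b x j m<j)) ,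
    trans (alt≡transitions x) (trans (transitions-prefixFlip-suc flip ends) (cong suc (sym (alt≡transitions y))))
    where
    b = zeroFlags x zero
    y = flipPrefix m b x
    flip : PrefixFlip m b (zeroFlags x) (zeroFlags y)
    flip = record
      { prefixˡ = block
      ; prefixʳ = flipPrefix-inside m b x
      ; suffix  = λ j m<j → cong isZeroᵇ (sym (flipPrefix-outside m b x j m<j))
      }

mainTheorem4 : (k : ℕ) → 1 ≤ k → (ns : Fin k → ℕ) → ((i : Fin k) → 2 ≤ ns i) →
    (x : Vertex ns) → alt x ≢ 0 →
    (Σ (Vertex ns) λ y → Adjacent x y × alt y ≡ alt x ∸ 1)
    × ((y′ : Vertex ns) → Adjacent x y′ → ¬ (alt y′ < alt x ∸ 1))
mainTheorem4 (suc k) _ ns 2≤ns x alt≢0 = descent , noSteeperDescent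
  where
  descent : Σ (Vertex ns) λ y → Adjacent x y × alt y ≡ alt x ∸ 1
  descent with alt-descent 2≤ns x alt≢0
  ... | y , x~y , altx≡1+alty = y , x~y , cong (_∸ 1) (sym altx≡1+alty)
  noSteeperDescent : (y′ : Vertex ns) → Adjacent x y′ → ¬ (alt y′ < alt x ∸ 1)
  noSteeperDescent y′ x~y′ = ≤⇒≯ (∸-monoˡ-≤ 1 (alt-adjacent-≤ x~y′))
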